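{- Let $n>3$ be an integer, and let $G$ and $H$ be finite digraphs with maximum degree less than $n$. Then there exists a $\mathbb{Z}_n$-flow-continuous mapping $E(G)\to E(H)$ if and only if there exists a $\mathbb{Z}$-flow-continuous mapping $E(G)\to E(H)$.
   Context: Digraphs are finite multidigraphs; loops and parallel edges are allowed. For an abelian group $M$, a map $\varphi:E(G)\to M$ is an $M$-flow if at every vertex $v$ the sum of $\varphi$ over edges leaving $v$ equals the sum of $\varphi$ over edges entering $v$. A mapping $f:E(G)\to E(H)$ is $M$-flow-continuous if for every $M$-flow $\varphi$ on $H$ the composition $\varphi\circ f$ is an $M$-flow on $G$. -}

module Defs where

open import Level using (0ℓ)
open import Algebra.Bundles.Raw using (RawMonoid)
open import Data.Nat using (ℕ; zero; suc; _+_; _<_; NonZero)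
open import Data.Nat.DivMod using (_mod_)
open import Data.Fin using (Fin; toℕ; _≟_)
import Data.Fin as F
open import Data.Integer using (ℤ)
import Data.Integer as Int
open import Relation.Nullary using (does)
open import Relation.Binary.PropositionalEquality using (_≡_)
open import Data.Bool using (if_then_else_)

record Digraph : Set where
  field
    V    : ℕ
    E    : ℕ
    tail : Fin E → Fin V
    head : Fin E → Fin V
open Digraph public

module _ (M : RawMonoid 0ℓ 0ℓ) where
  open RawMonoid M
  Σ-fin : (k : ℕ) → (Fin k → Carrier) → Carrier
  Σ-fin zero    g = ε
  Σ-fin (suc k) g = g F.zero ∙ Σ-fin k (λ i → g (F.suc i))

  outSum : (G : Digraph) → (Fin (E G) → Carrier) → Fin (V G) → Carrier
  outSum G φ v = Σ-fin (E G) (λ e → if does (tail G e ≟ v) then φ e else ε)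

  inSum : (G : Digraph) → (Fin (E G) → Carrier) → Fin (V G) → Carrier
  inSum G φ v = Σ-fin (E G) (λ e → if does (head G e ≟ v) then φ e else ε)

  IsFlow : (G : Digraph) → (Fin (E G) → Carrier) → Set
  IsFlow G φ = ∀ v → outSum G φ v ≈ inSum G φ v

  FlowContinuous : (G H : Digraph) → (Fin (E G) → Fin (E H)) → Set
  FlowContinuous G H f = ∀ (φ : Fin (E H) → Carrier) → IsFlow H φ → IsFlow G (λ e → φ (f e))

-- The additive group ℤ (as a raw monoid: flows only use + and 0).
ℤ-group : RawMonoid 0ℓ 0ℓ
ℤ-group = Int.+-0-rawMonoid

ℤ/_ : (n : ℕ) → .{{_ : NonZero n}} → RawMonoid 0ℓ 0ℓ
ℤ/ n = record
  { Carrier = Fin n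
  ; _≈_     = _≡_
  ; _∙_     = λ a b → (toℕ a + toℕ b) mod n
  ; ε       = 0 mod n
  }

-- degree of a vertex: out-degree + in-degree (a loop contributes 2)
degree : (G : Digraph) → Fin (V G) → ℕ
degree G v = outSum Data.Nat.+-0-rawMonoid G (λ _ → 1) v + inSum Data.Nat.+-0-rawMonoid G (λ _ → 1) v

MaxDegreeLess : Digraph → ℕ → Set
MaxDegreeLess G n = ∀ v → degree G v < n

-- For a vertex v of G, the net flow of φ ∘ f at v is ⟨ c_v , φ ⟩, where c_v is the pushforward
-- along f of the incidence vector of v. So f is M-flow-continuous iff every c_v annihilates all
-- M-flows on H. Working in ℤ modulo m (m = 0 for ℤ, m = n for ℤ_n), a functional annihilates
-- all flows iff it is a tension (the coboundary of a potential), by contracting the edges one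
-- at a time. An integer tension is a tension mod n. Conversely, a tension mod n with ℓ¹-norm
-- below n is an integer tension: the arcs of ℤ/n swept by its edges miss some residue, and
-- cutting the circle there unrolls the potential to ℤ. Finally ‖ c_v ‖₁ ≤ deg v < n.
module Submission where

open import Defs
open import Level using (0ℓ)
open import Algebra.Bundles using (Semiring)
open import Data.Bool using (true; false; if_then_else_)
open import Data.Empty using (⊥-elim)
open import Data.Fin using (Fin; zero; suc; toℕ; fromℕ<; _≟_)
import Data.Fin.Properties as FinP
open import Data.Nat as ℕ using (ℕ; zero; suc; NonZero; _<_)
import Data.Nat.Properties as ℕP
open import Data.Product using (Σ; ∃; _×_; _,_; proj₁; proj₂)
open import Data.Vec.Functional using (Vector; _∷_)
open import Function using (_∘_)
open import Function.Bundles using (_⇔_; mk⇔; module Equivalence)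
open import Relation.Binary.Bundles using (Setoid)
open import Relation.Binary.PropositionalEquality using (_≡_; _≢_; refl; sym; trans; cong; cong₂; subst; module ≡-Reasoning)
open import Relation.Nullary using (does; yes; no; ¬_)
open import Relation.Nullary.Decidable using (dec-true; dec-false)

module IndicatorSum {c ℓ} (R : Semiring c ℓ) where
  open Semiring R hiding (zero; refl; sym; trans)
  open import Algebra.Properties.Semiring.Sum R using (sum; sum-cong-≋; sum-replicate-zero)
  open import Relation.Binary.Reasoning.Setoid setoid

  indicator : ∀ {k} → Fin k → Fin k → Carrier
  indicator i j = if does (i ≟ j) then 1# else 0#

  indicator-refl : ∀ {k} (i : Fin k) → indicator i i ≡ 1#
  indicator-refl i = cong (if_then 1# else 0#) (dec-true (i ≟ i) refl)

  indicator-≢ : ∀ {k} {i j : Fin k} → i ≢ j → indicator i j ≡ 0#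
  indicator-≢ {i = i} {j} i≢j = cong (if_then 1# else 0#) (dec-false (i ≟ j) i≢j)

  ∑-indicator : ∀ {k} (a : Fin k) (g : Vector Carrier k) → sum (λ i → indicator a i * g i) ≈ g a
  ∑-indicator {suc k} zero g = begin
    1# * g zero + sum (λ i → 0# * g (suc i))
      ≈⟨ +-cong (*-identityˡ _) (sum-cong-≋ (λ i → zeroˡ (g (suc i)))) ⟩
    g zero + sum {k} (λ _ → 0#)  ≈⟨ +-congˡ (sum-replicate-zero k) ⟩
    g zero + 0#                  ≈⟨ +-identityʳ _ ⟩
    g zero                       ∎
  ∑-indicator {suc k} (suc a) g = begin
    0# * g zero + sum (λ i → indicator a i * g (suc i)) ≈⟨ +-cong (zeroˡ _) (∑-indicator a (g ∘ suc)) ⟩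
    0# + g (suc a)                                     ≈⟨ +-identityˡ _ ⟩
    g (suc a)                                          ∎

open import Data.Integer using (ℤ; +_; +[1+_]; -[1+_]; 0ℤ; 1ℤ; -1ℤ; _+_; _*_; -_; _-_; ∣_∣)
import Data.Integer.Properties as ℤP
open import Data.Nat.DivMod using (_mod_)
open import Data.Integer.DivMod using (_%ℕ_; _/ℕ_; n%ℕd<d; a≡a%ℕn+[a/ℕn]*n)
open import Data.Integer.Tactic.RingSolver using (solve-∀)
open import Data.List as List using (List; length; concat; tabulate)
open import Data.List.Properties using (length-++)
open import Data.List.Membership.Propositional using (_∈_; _∉_)
open import Data.List.Membership.Propositional.Properties using (∈-concat⁺′; ∈-tabulate⁺)
open import Data.List.Membership.Setoid.Properties using (index-injective)
open import Data.List.Relation.Unary.Any as Any using (here; there)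
import Relation.Binary.PropositionalEquality as ≡
open import Algebra.Properties.Semiring.Sum ℤP.+-*-semiring
  using (sum; sum-cong-≗; sum-replicate-zero; ∑-distrib-+; ∑-comm; *-distribˡ-sum; *-distribʳ-sum)
import Algebra.Properties.Semiring.Sum as SemiringSum
module ℕΣ = SemiringSum ℕP.+-*-semiring
module ℕIndicator = IndicatorSum ℕP.+-*-semiring
open IndicatorSum ℤP.+-*-semiring using (indicator; indicator-refl; indicator-≢; ∑-indicator)

-- Congruence modulo m (m = 0 is equality)

record _≡[_]_ (a : ℤ) (m : ℕ) (b : ℤ) : Set where
  constructor multiple
  field
    factor   : ℤ
    equation : a ≡ b + factor * + m

infix 4 _≡[_]_

module _ {m : ℕ} where

  mod-reflexive : ∀ {a b} → a ≡ b → a ≡[ m ] b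
  mod-reflexive {a} refl = multiple 0ℤ (lemma a (+ m))
    where
    lemma : ∀ a m → a ≡ a + 0ℤ * m
    lemma = solve-∀

  mod-refl : ∀ {a} → a ≡[ m ] a
  mod-refl = mod-reflexive refl

  mod-sym : ∀ {a b} → a ≡[ m ] b → b ≡[ m ] a
  mod-sym {b = b} (multiple k refl) = multiple (- k) (lemma b k (+ m))
    where
    lemma : ∀ b k m → b ≡ b + k * m + - k * m
    lemma = solve-∀

  mod-trans : ∀ {a b c} → a ≡[ m ] b → b ≡[ m ] c → a ≡[ m ] c
  mod-trans {c = c} (multiple k refl) (multiple l refl) = multiple (l + k) (lemma c l k (+ m))
    where
    lemma : ∀ c l k m → c + l * m + k * m ≡ c + (l + k) * m
    lemma = solve-∀

  mod-setoid : Setoid 0ℓ 0ℓ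
  mod-setoid = record
    { Carrier       = ℤ
    ; _≈_           = λ a b → a ≡[ m ] b
    ; isEquivalence = record { refl = mod-refl ; sym = mod-sym ; trans = mod-trans }
    }

  +-cong-mod : ∀ {a b c d} → a ≡[ m ] b → c ≡[ m ] d → a + c ≡[ m ] b + d
  +-cong-mod {b = b} {d = d} (multiple k refl) (multiple l refl) = multiple (k + l) (lemma b d k l (+ m))
    where
    lemma : ∀ b d k l m → b + k * m + (d + l * m) ≡ b + d + (k + l) * m
    lemma = solve-∀

  *-congˡ-mod : ∀ c {a b} → a ≡[ m ] b → c * a ≡[ m ] c * b
  *-congˡ-mod c {b = b} (multiple k refl) = multiple (c * k) (lemma b c k (+ m))
    where
    lemma : ∀ b c k m → c * (b + k * m) ≡ c * b + c * k * m
    lemma = solve-∀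

  -‿cong-mod : ∀ {a b} → a ≡[ m ] b → - a ≡[ m ] - b
  -‿cong-mod {b = b} (multiple k refl) = multiple (- k) (lemma b k (+ m))
    where
    lemma : ∀ b k m → - (b + k * m) ≡ - b + - k * m
    lemma = solve-∀

  -cong-mod : ∀ {a b c d} → a ≡[ m ] b → c ≡[ m ] d → a - c ≡[ m ] b - d
  -cong-mod p q = +-cong-mod p (-‿cong-mod q)

  diff≡0⇒mod : ∀ {a b} → a - b ≡[ m ] 0ℤ → a ≡[ m ] b
  diff≡0⇒mod {a} {b} p = mod-trans (mod-reflexive (lemma a b))
    (mod-trans (+-cong-mod p (mod-refl {b})) (mod-reflexive (ℤP.+-identityˡ b)))
    where
    lemma : ∀ a b → a ≡ a - b + b
    lemma = solve-∀

  mod⇒diff≡0 : ∀ {a b} → a ≡[ m ] b → a - b ≡[ m ] 0ℤ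
  mod⇒diff≡0 {a} {b} p = mod-trans (-cong-mod p (mod-refl {b})) (mod-reflexive (ℤP.+-inverseʳ b))

module mod-Reasoning (m : ℕ) where
  open import Relation.Binary.Reasoning.Setoid (mod-setoid {m}) public

modulus-mod : ∀ m → + m ≡[ m ] 0ℤ
modulus-mod m = multiple 1ℤ (sym (trans (ℤP.+-identityˡ (1ℤ * + m)) (ℤP.*-identityˡ (+ m))))

mod-shift : ∀ {m a b c} → c ≡[ m ] a - b → a ≡[ m ] b + c
mod-shift {m} {a} {b} {c} p = mod-trans (mod-reflexive (lemma a b)) (+-cong-mod (mod-refl {m} {b}) (mod-sym p))
  where
  lemma : ∀ a b → a ≡ b + (a - b)
  lemma = solve-∀

mod-0⇒≡ : ∀ {a b} → a ≡[ 0 ] b → a ≡ b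
mod-0⇒≡ {b = b} (multiple k refl) = trans (cong (_+_ b) (ℤP.*-zeroʳ k)) (ℤP.+-identityʳ b)

mod-0⇒mod : ∀ {m a b} → a ≡[ 0 ] b → a ≡[ m ] b
mod-0⇒mod = mod-reflexive ∘ mod-0⇒≡

⌜_⌝ : ∀ {n} → Fin n → ℤ
⌜ a ⌝ = + toℕ a

module _ {n : ℕ} .{{_ : NonZero n}} where

  %ℕ-mod : ∀ z → + (z %ℕ n) ≡[ n ] z
  %ℕ-mod z = mod-sym (multiple (z /ℕ n) (a≡a%ℕn+[a/ℕn]*n z n))

  private
    n≤-shifted : ∀ a b k → + a ≡ + b + + suc k * + n → n ℕ.≤ a
    n≤-shifted a b k eq = begin
      n               ≤⟨ ℕP.m≤m+n n (k ℕ.* n) ⟩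
      suc k ℕ.* n     ≤⟨ ℕP.m≤n+m _ b ⟩
      b ℕ.+ suc k ℕ.* n ≡⟨ ℤP.+-injective a≡ ⟨
      a               ∎
      where
      open ℕP.≤-Reasoning
      a≡ : + a ≡ + (b ℕ.+ suc k ℕ.* n)
      a≡ = trans eq (trans (cong (_+_ (+ b)) (sym (ℤP.pos-* (suc k) n))) (sym (ℤP.pos-+ b _)))

  canonical-mod : ∀ {a b} → a ℕ.< n → b ℕ.< n → + a ≡[ n ] + b → a ≡ b
  canonical-mod {b = b} _ _ (multiple (+ zero) eq) = ℤP.+-injective (trans eq (ℤP.+-identityʳ (+ b)))
  canonical-mod {a} {b} a<n _ (multiple +[1+ k ] eq) = ⊥-elim (ℕP.<⇒≱ a<n (n≤-shifted a b k eq))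
  canonical-mod {a} {b} _ b<n (multiple -[1+ k ] eq) =
    ⊥-elim (ℕP.<⇒≱ b<n (n≤-shifted b a k (flip (+ a) (+ b) (+ suc k) (+ n) eq)))
    where
    flip : ∀ a b k n → a ≡ b + - k * n → b ≡ a + k * n
    flip a b k n refl = lemma b k n
      where
      lemma : ∀ b k n → b ≡ b + - k * n + k * n
      lemma = solve-∀

  residue : ℤ → Fin n
  residue z = fromℕ< (n%ℕd<d z n)

  ⌜residue⌝ : ∀ z → ⌜ residue z ⌝ ≡[ n ] z
  ⌜residue⌝ z = mod-trans (mod-reflexive (cong +_ (FinP.toℕ-fromℕ< (n%ℕd<d z n)))) (%ℕ-mod z)

  ⌜⌝-injective-mod : ∀ {a b : Fin n} → ⌜ a ⌝ ≡[ n ] ⌜ b ⌝ → a ≡ b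
  ⌜⌝-injective-mod {a} {b} p = FinP.toℕ-injective (canonical-mod (FinP.toℕ<n a) (FinP.toℕ<n b) p)

⟨_,_⟩ : ∀ {k} → Vector ℤ k → Vector ℤ k → ℤ
⟨ a , b ⟩ = sum (λ i → a i * b i)

module _ {m : ℕ} where

  *-congʳ-mod : ∀ c {a b} → a ≡[ m ] b → a * c ≡[ m ] b * c
  *-congʳ-mod c {a} {b} p =
    mod-trans (mod-reflexive (ℤP.*-comm a c)) (mod-trans (*-congˡ-mod c p) (mod-reflexive (ℤP.*-comm c b)))

  ∑-cong-mod : ∀ {k} {f g : Vector ℤ k} → (∀ i → f i ≡[ m ] g i) → sum f ≡[ m ] sum g
  ∑-cong-mod {zero}  _ = mod-refl
  ∑-cong-mod {suc k} p = +-cong-mod (p zero) (∑-cong-mod (p ∘ suc))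

  ⟨⟩-congˡ-mod : ∀ {k} {a a′ : Vector ℤ k} b → (∀ i → a i ≡[ m ] a′ i) → ⟨ a , b ⟩ ≡[ m ] ⟨ a′ , b ⟩
  ⟨⟩-congˡ-mod b p = ∑-cong-mod (λ i → *-congʳ-mod (b i) (p i))

  ⟨⟩-congʳ-mod : ∀ {k} a {b b′ : Vector ℤ k} → (∀ i → b i ≡[ m ] b′ i) → ⟨ a , b ⟩ ≡[ m ] ⟨ a , b′ ⟩
  ⟨⟩-congʳ-mod a p = ∑-cong-mod (λ i → *-congˡ-mod (a i) (p i))

⟨⟩-zeroʳ : ∀ {k} (a : Vector ℤ k) → ⟨ a , (λ _ → 0ℤ) ⟩ ≡ 0ℤ
⟨⟩-zeroʳ {k} a = trans (sum-cong-≗ (ℤP.*-zeroʳ ∘ a)) (sum-replicate-zero k)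

∑-distrib-- : ∀ {k} (f g : Vector ℤ k) → sum (λ i → f i - g i) ≡ sum f - sum g
∑-distrib-- f g = trans (∑-distrib-+ f (-_ ∘ g)) (cong (_+_ (sum f)) ∑-neg)
  where
  ∑-neg : sum (-_ ∘ g) ≡ - sum g
  ∑-neg = begin
    sum (-_ ∘ g)                ≡⟨ sum-cong-≗ (sym ∘ ℤP.-1*i≡-i ∘ g) ⟩
    sum (λ i → -1ℤ * g i)       ≡⟨ *-distribˡ-sum -1ℤ g ⟨
    -1ℤ * sum g                 ≡⟨ ℤP.-1*i≡-i (sum g) ⟩
    - sum g                     ∎
    where open ≡-Reasoning

⟨⟩-linearˡ : ∀ {k} (a b φ : Vector ℤ k) s → ⟨ (λ i → a i + s * b i) , φ ⟩ ≡ ⟨ a , φ ⟩ + s * ⟨ b , φ ⟩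
⟨⟩-linearˡ a b φ s = begin
  sum (λ i → (a i + s * b i) * φ i)
    ≡⟨ sum-cong-≗ (λ i → distrib (a i) s (b i) (φ i)) ⟩
  sum (λ i → a i * φ i + s * (b i * φ i))
    ≡⟨ ∑-distrib-+ (λ i → a i * φ i) (λ i → s * (b i * φ i)) ⟩
  ⟨ a , φ ⟩ + sum (λ i → s * (b i * φ i))
    ≡⟨ cong (_+_ ⟨ a , φ ⟩) (*-distribˡ-sum s (λ i → b i * φ i)) ⟨
  ⟨ a , φ ⟩ + s * ⟨ b , φ ⟩ ∎
  where
  open ≡-Reasoning
  distrib : ∀ a s b φ → (a + s * b) * φ ≡ a * φ + s * (b * φ)
  distrib = solve-∀

⟨⟩-transpose : ∀ {k l} (M : Fin k → Fin l → ℤ) (x : Vector ℤ l) (y : Vector ℤ k)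
  → ⟨ (λ i → ⟨ M i , x ⟩) , y ⟩ ≡ ⟨ x , (λ j → ⟨ (λ i → M i j) , y ⟩) ⟩
⟨⟩-transpose M x y = begin
  sum (λ i → sum (λ j → M i j * x j) * y i)
    ≡⟨ sum-cong-≗ (λ i → *-distribʳ-sum (y i) (λ j → M i j * x j)) ⟩
  sum (λ i → sum (λ j → M i j * x j * y i))
    ≡⟨ ∑-comm (λ i j → M i j * x j * y i) ⟩
  sum (λ j → sum (λ i → M i j * x j * y i))
    ≡⟨ sum-cong-≗ (λ j → sum-cong-≗ (λ i → rearrange (M i j) (x j) (y i))) ⟩
  sum (λ j → sum (λ i → x j * (M i j * y i)))
    ≡⟨ sum-cong-≗ (λ j → *-distribˡ-sum (x j) (λ i → M i j * y i)) ⟨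
  sum (λ j → x j * sum (λ i → M i j * y i)) ∎
  where
  open ≡-Reasoning
  rearrange : ∀ a b c → a * b * c ≡ b * (a * c)
  rearrange = solve-∀

⟨⟩-distrib-- : ∀ {k} (a b φ : Vector ℤ k) → ⟨ (λ i → a i - b i) , φ ⟩ ≡ ⟨ a , φ ⟩ - ⟨ b , φ ⟩
⟨⟩-distrib-- a b φ =
  trans (sum-cong-≗ (λ i → distribʳ-- (a i) (b i) (φ i))) (∑-distrib-- (λ i → a i * φ i) (λ i → b i * φ i))
  where
  distribʳ-- : ∀ a b c → (a - b) * c ≡ a * c - b * c
  distribʳ-- = solve-∀

-- Flows and tensions modulo m

incidence : (G : Digraph) → Fin (V G) → Fin (E G) → ℤ
incidence G v e = indicator (tail G e) v - indicator (head G e) v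

∂ : (G : Digraph) → Vector ℤ (E G) → Vector ℤ (V G)
∂ G φ v = ⟨ incidence G v , φ ⟩

coboundary : (G : Digraph) → Vector ℤ (V G) → Vector ℤ (E G)
coboundary G q e = q (tail G e) - q (head G e)

IsFlowMod : ℕ → (G : Digraph) → Vector ℤ (E G) → Set
IsFlowMod m G φ = ∀ v → ∂ G φ v ≡[ m ] 0ℤ

IsTensionMod : ℕ → (G : Digraph) → Vector ℤ (E G) → Set
IsTensionMod m G c = ∃ λ q → ∀ e → c e ≡[ m ] coboundary G q e

AnnihilatesFlowsMod : ℕ → (G : Digraph) → Vector ℤ (E G) → Set
AnnihilatesFlowsMod m G c = ∀ φ → IsFlowMod m G φ → ⟨ c , φ ⟩ ≡[ m ] 0ℤ

outflow inflow : (G : Digraph) → Vector ℤ (E G) → Vector ℤ (V G)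
outflow G φ v = ⟨ (λ e → indicator (tail G e) v) , φ ⟩
inflow  G φ v = ⟨ (λ e → indicator (head G e) v) , φ ⟩

isFlowMod⇔balanced : ∀ {m} G φ → IsFlowMod m G φ ⇔ (∀ v → outflow G φ v ≡[ m ] inflow G φ v)
isFlowMod⇔balanced G φ = mk⇔
  (λ flow v → diff≡0⇒mod (subst (_≡[ _ ] 0ℤ) (∂≡ v) (flow v)))
  (λ balanced v → subst (_≡[ _ ] 0ℤ) (sym (∂≡ v)) (mod⇒diff≡0 (balanced v)))
  where
  ∂≡ : ∀ v → ∂ G φ v ≡ outflow G φ v - inflow G φ v
  ∂≡ v = ⟨⟩-distrib-- (λ e → indicator (tail G e) v) (λ e → indicator (head G e) v) φ

isFlowMod-resp : ∀ {m} G {φ φ′} → (∀ e → φ e ≡[ m ] φ′ e) → IsFlowMod m G φ → IsFlowMod m G φ′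
isFlowMod-resp G φ≡φ′ flow v = mod-trans (mod-sym (⟨⟩-congʳ-mod (incidence G v) φ≡φ′)) (flow v)

coboundary-as-⟨⟩ : ∀ G q e → coboundary G q e ≡ ⟨ (λ v → incidence G v e) , q ⟩
coboundary-as-⟨⟩ G q e = sym (trans
  (⟨⟩-distrib-- (λ v → indicator (tail G e) v) (λ v → indicator (head G e) v) q)
  (cong₂ _-_ (∑-indicator (tail G e) q) (∑-indicator (head G e) q)))

⟨coboundary,⟩ : ∀ G q φ → ⟨ coboundary G q , φ ⟩ ≡ ⟨ q , ∂ G φ ⟩
⟨coboundary,⟩ G q φ = trans (sum-cong-≗ (λ e → cong (_* φ e) (coboundary-as-⟨⟩ G q e)))
                             (⟨⟩-transpose (λ e v → incidence G v e) q φ)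

tension⇒annihilates : ∀ {m} G c → IsTensionMod m G c → AnnihilatesFlowsMod m G c
tension⇒annihilates {m} G c (q , c≡δq) φ flow = begin
  ⟨ c , φ ⟩              ≈⟨ ⟨⟩-congˡ-mod φ c≡δq ⟩
  ⟨ coboundary G q , φ ⟩ ≡⟨ ⟨coboundary,⟩ G q φ ⟩
  ⟨ q , ∂ G φ ⟩          ≈⟨ ⟨⟩-congʳ-mod q flow ⟩
  ⟨ q , (λ _ → 0ℤ) ⟩     ≡⟨ ⟨⟩-zeroʳ q ⟩
  0ℤ                     ∎
  where open mod-Reasoning m

-- Every functional annihilating all flows is a tension

digraph : ∀ {V E} → (Fin E → Fin V) → (Fin E → Fin V) → Digraph
digraph {V} {E} t h = record { V = V ; E = E ; tail = t ; head = h }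

contract : ∀ {V} → Fin V → Fin V → Fin V → Fin V
contract u w x = if does (x ≟ w) then u else x

contract-self : ∀ {V} (u w : Fin V) → contract u w w ≡ u
contract-self u w = cong (if_then u else w) (dec-true (w ≟ w) refl)

contract-≢ : ∀ {V} (u w : Fin V) {x} → x ≢ w → contract u w x ≡ x
contract-≢ u w {x} x≢w = cong (if_then u else x) (dec-false (x ≟ w) x≢w)

indicator-contract : ∀ {V} (u w y x : Fin V)
  → indicator (contract u w y) x ≡ indicator y x + indicator y w * (indicator u x - indicator w x)
indicator-contract u w y x with y ≟ w
... | yes refl = sym (lemma (indicator u x) (indicator y x))
  where
  lemma : ∀ a b → b + 1ℤ * (a - b) ≡ a
  lemma = solve-∀
... | no _ = sym (ℤP.+-identityʳ (indicator y x))

∂-contract : ∀ {V E} (u w : Fin V) (t h : Fin E → Fin V) φ x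
  → ∂ (digraph (contract u w ∘ t) (contract u w ∘ h)) φ x
    ≡ ∂ (digraph t h) φ x + (indicator u x - indicator w x) * ∂ (digraph t h) φ w
∂-contract u w t h φ x =
  trans (sum-cong-≗ (λ e → cong (_* φ e) (incidence-contract e)))
        (⟨⟩-linearˡ (incidence G x) (incidence G w) φ (indicator u x - indicator w x))
  where
  G : Digraph
  G = digraph t h
  incidence-contract : ∀ e → incidence (digraph (contract u w ∘ t) (contract u w ∘ h)) x e
    ≡ incidence G x e + (indicator u x - indicator w x) * incidence G w e
  incidence-contract e =
    trans (cong₂ _-_ (indicator-contract u w (t e) x) (indicator-contract u w (h e) x))
          (lemma (indicator (t e) x) (indicator (h e) x) (indicator (t e) w) (indicator (h e) w)
                 (indicator u x - indicator w x))
    where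
    lemma : ∀ a b a′ b′ d → a + a′ * d - (b + b′ * d) ≡ a - b + d * (a′ - b′)
    lemma = solve-∀

module _ {V E : ℕ} (t h : Fin (suc E) → Fin V) where

  deleteFirst : Digraph
  deleteFirst = digraph (t ∘ suc) (h ∘ suc)

  contractFirst : Digraph
  contractFirst = digraph (contract (t zero) (h zero) ∘ t ∘ suc) (contract (t zero) (h zero) ∘ h ∘ suc)

  -- Chosen so that ⟨ contractFunctional c , φ ⟩ ≡ ⟨ c , ∂ deleteFirst φ (h zero) ∷ φ ⟩, where
  -- ∂ deleteFirst φ (h zero) ∷ φ is a flow on digraph t h whenever φ is one on contractFirst.
  contractFunctional : Vector ℤ (suc E) → Vector ℤ E
  contractFunctional c e = c (suc e) + c zero * incidence deleteFirst (h zero) e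

  private
    G : Digraph
    G = digraph t h

  annihilates-deleteLoop : ∀ {m} c → t zero ≡ h zero → AnnihilatesFlowsMod m G c
    → c zero ≡[ m ] 0ℤ × AnnihilatesFlowsMod m deleteFirst (c ∘ suc)
  annihilates-deleteLoop {m} c loop annihilates = c₀≡0 , annihilates⁻
    where
    ∂-extend : ∀ a φ x → ∂ G (a ∷ φ) x ≡ ∂ deleteFirst φ x
    ∂-extend a φ x = begin
      incidence G x zero * a + ∂ deleteFirst φ x ≡⟨ cong (λ d → d * a + ∂ deleteFirst φ x) loop-incidence ⟩
      0ℤ * a + ∂ deleteFirst φ x                 ≡⟨ ℤP.+-identityˡ _ ⟩
      ∂ deleteFirst φ x                          ∎
      where
      open ≡-Reasoning
      loop-incidence : incidence G x zero ≡ 0ℤ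
      loop-incidence = trans (cong (λ y → indicator (t zero) x - indicator y x) (sym loop))
                             (ℤP.+-inverseʳ (indicator (t zero) x))
    c₀≡0 : c zero ≡[ m ] 0ℤ
    c₀≡0 = begin
      c zero                   ≡⟨ ℤP.*-identityʳ (c zero) ⟨
      c zero * 1ℤ              ≡⟨ ℤP.+-identityʳ _ ⟨
      c zero * 1ℤ + 0ℤ         ≡⟨ cong (_+_ (c zero * 1ℤ)) (⟨⟩-zeroʳ (c ∘ suc)) ⟨
      ⟨ c , 1ℤ ∷ (λ _ → 0ℤ) ⟩  ≈⟨ annihilates (1ℤ ∷ λ _ → 0ℤ) indicator-flow ⟩
      0ℤ                       ∎
      where
      open mod-Reasoning m
      indicator-flow : IsFlowMod m G (1ℤ ∷ λ _ → 0ℤ)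
      indicator-flow x = mod-reflexive (trans (∂-extend 1ℤ _ x) (⟨⟩-zeroʳ (incidence deleteFirst x)))
    annihilates⁻ : AnnihilatesFlowsMod m deleteFirst (c ∘ suc)
    annihilates⁻ φ flow = begin
      ⟨ c ∘ suc , φ ⟩       ≡⟨ ℤP.+-identityˡ _ ⟨
      0ℤ + ⟨ c ∘ suc , φ ⟩  ≡⟨ cong (_+ ⟨ c ∘ suc , φ ⟩) (ℤP.*-zeroʳ (c zero)) ⟨
      ⟨ c , 0ℤ ∷ φ ⟩        ≈⟨ annihilates (0ℤ ∷ φ) extended-flow ⟩
      0ℤ                    ∎
      where
      open mod-Reasoning m
      extended-flow : IsFlowMod m G (0ℤ ∷ φ)
      extended-flow x = subst (_≡[ m ] 0ℤ) (sym (∂-extend 0ℤ φ x)) (flow x)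

  tension-addLoop : ∀ {m} c → t zero ≡ h zero → c zero ≡[ m ] 0ℤ
    → IsTensionMod m deleteFirst (c ∘ suc) → IsTensionMod m G c
  tension-addLoop c loop c₀≡0 (q , c≡δq) = q , λ where
    zero    → mod-trans c₀≡0 (mod-reflexive (sym (trans (cong (λ y → q (t zero) - q y) (sym loop))
                                                         (ℤP.+-inverseʳ (q (t zero))))))
    (suc e) → c≡δq e

  annihilates-contractFirst : ∀ {m} c → AnnihilatesFlowsMod m G c
    → AnnihilatesFlowsMod m contractFirst (contractFunctional c)
  annihilates-contractFirst {m} c annihilates φ flow = begin
    ⟨ contractFunctional c , φ ⟩
      ≡⟨ ⟨⟩-linearˡ (c ∘ suc) (incidence deleteFirst (h zero)) φ (c zero) ⟩
    ⟨ c ∘ suc , φ ⟩ + c zero * ∂⁻φ (h zero)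
      ≡⟨ ℤP.+-comm ⟨ c ∘ suc , φ ⟩ (c zero * ∂⁻φ (h zero)) ⟩
    ⟨ c , ∂⁻φ (h zero) ∷ φ ⟩
      ≈⟨ annihilates (∂⁻φ (h zero) ∷ φ) extended-flow ⟩
    0ℤ ∎
    where
    open mod-Reasoning m
    ∂⁻φ : Vector ℤ V
    ∂⁻φ = ∂ deleteFirst φ
    extended-flow : IsFlowMod m G (∂⁻φ (h zero) ∷ φ)
    extended-flow x = subst (_≡[ m ] 0ℤ)
      (trans (∂-contract (t zero) (h zero) (t ∘ suc) (h ∘ suc) φ x)
             (ℤP.+-comm (∂⁻φ x) (incidence G x zero * ∂⁻φ (h zero)))) (flow x)

  tension-uncontractFirst : ∀ {m} c → t zero ≢ h zero
    → IsTensionMod m contractFirst (contractFunctional c) → IsTensionMod m G c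
  tension-uncontractFirst {m} c u≢w (q , c′≡δq) = q′ , c≡δq′
    where
    u w : Fin V
    u = t zero
    w = h zero
    q′ : Vector ℤ V
    q′ x = q (contract u w x) - c zero * indicator x w
    c≡δq′ : ∀ e → c e ≡[ m ] q′ (t e) - q′ (h e)
    c≡δq′ zero = mod-reflexive (sym (begin
      q (contract u w u) - c zero * indicator u w - (q (contract u w w) - c zero * indicator w w)
        ≡⟨ cong₂ (λ x y → q x - c zero * y - (q (contract u w w) - c zero * indicator w w))
                 (contract-≢ u w u≢w) (indicator-≢ u≢w) ⟩
      q u - c zero * 0ℤ - (q (contract u w w) - c zero * indicator w w)
        ≡⟨ cong₂ (λ x y → q u - c zero * 0ℤ - (q x - c zero * y)) (contract-self u w) (indicator-refl w) ⟩
      q u - c zero * 0ℤ - (q u - c zero * 1ℤ)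
        ≡⟨ lemma (q u) (c zero) ⟩
      c zero ∎))
      where
      open ≡-Reasoning
      lemma : ∀ a c → a - c * 0ℤ - (a - c * 1ℤ) ≡ c
      lemma = solve-∀
    c≡δq′ (suc e) = begin
      c (suc e)
        ≡⟨ lemma (c (suc e)) (c zero * incidence deleteFirst w e) ⟩
      contractFunctional c e - c zero * incidence deleteFirst w e
        ≈⟨ -cong-mod (c′≡δq e) mod-refl ⟩
      q (contract u w x) - q (contract u w y) - c zero * (indicator x w - indicator y w)
        ≡⟨ lemma′ (q (contract u w x)) (q (contract u w y)) (c zero) (indicator x w) (indicator y w) ⟩
      q′ x - q′ y ∎
      where
      open mod-Reasoning m
      x y : Fin V
      x = t (suc e)
      y = h (suc e)
      lemma : ∀ a d → a ≡ a + d - d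
      lemma = solve-∀
      lemma′ : ∀ a b c x y → a - b - c * (x - y) ≡ a - c * x - (b - c * y)
      lemma′ = solve-∀

annihilates⇒tension : ∀ {m V E} (t h : Fin E → Fin V) c
  → AnnihilatesFlowsMod m (digraph t h) c → IsTensionMod m (digraph t h) c
annihilates⇒tension {E = zero} t h c _ = (λ _ → 0ℤ) , λ ()
annihilates⇒tension {E = suc E} t h c annihilates with t zero ≟ h zero
... | yes loop =
  let c₀≡0 , annihilates⁻ = annihilates-deleteLoop t h c loop annihilates
  in tension-addLoop t h c loop c₀≡0 (annihilates⇒tension (t ∘ suc) (h ∘ suc) (c ∘ suc) annihilates⁻)
... | no ¬loop = tension-uncontractFirst t h c ¬loop
  (annihilates⇒tension _ _ (contractFunctional t h c) (annihilates-contractFirst t h c annihilates))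

-- Tensions modulo n of ℓ¹-norm below n are integer tensions

∃∉ : ∀ {n} (xs : List (Fin n)) → length xs ℕ.< n → ∃ λ x → x ∉ xs
∃∉ {n} xs |xs|<n = FinP.¬∀⟶∃¬ n (_∈ xs) (λ x → Any.any? (x ≟_) xs) not-all
  where
  not-all : ¬ (∀ x → x ∈ xs)
  not-all all∈ with FinP.pigeonhole |xs|<n (Any.index ∘ all∈)
  ... | i , j , i<j , same-index = FinP.<⇒≢ i<j (index-injective (≡.setoid (Fin n)) (all∈ i) (all∈ j) same-index)

length-concat-tabulate : ∀ {A : Set} {k} (f : Fin k → List A) → length (concat (tabulate f)) ≡ ℕΣ.sum (length ∘ f)
length-concat-tabulate {k = zero}  f = refl
length-concat-tabulate {k = suc k} f =
  trans (length-++ (f zero)) (cong (ℕ._+_ (length (f zero))) (length-concat-tabulate (f ∘ suc)))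

pos-difference : ∀ {u v k} → u ≡ v ℕ.+ k → + k ≡ + u - + v
pos-difference {v = v} {k} refl = trans (lemma (+ v) (+ k)) (cong (_- + v) (sym (ℤP.pos-+ v k)))
  where
  lemma : ∀ v k → k ≡ v + k - v
  lemma = solve-∀

‖_‖₁ : ∀ {k} → Vector ℤ k → ℕ
‖ a ‖₁ = ℕΣ.sum (∣_∣ ∘ a)

module _ {n : ℕ} .{{_ : NonZero n}} where

  arc : ℤ → ℕ → List (Fin n)
  arc s zero    = List.[]
  arc s (suc k) = residue (s + + suc k) List.∷ arc s k

  length-arc : ∀ s k → length (arc s k) ≡ k
  length-arc s zero    = refl
  length-arc s (suc k) = cong suc (length-arc s k)

  ∈-arc : ∀ s {k j} → 0 ℕ.< j → j ℕ.≤ k → residue (s + + j) ∈ arc s k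
  ∈-arc s {zero}  0<j j≤0 = ⊥-elim (ℕP.<⇒≱ 0<j j≤0)
  ∈-arc s {suc k} {j} 0<j j≤1+k with j ℕ.≟ suc k
  ... | yes refl = here refl
  ... | no j≢1+k = there (∈-arc s 0<j (ℕ.s≤s⁻¹ (ℕP.≤∧≢⇒< j≤1+k j≢1+k)))

  -- Cuts the circle ℤ/n at x.
  unroll : Fin n → ℤ → ℕ
  unroll x z = (z - ⌜ x ⌝) %ℕ n

  unroll-arc : ∀ x s d k → d ≡[ n ] s + + k → x ∉ arc s k → unroll x d ≡ unroll x s ℕ.+ k
  unroll-arc x s d k d≡s+k x∉arc with unroll x s ℕ.+ k ℕ.<? n
  ... | yes <n = canonical-mod (n%ℕd<d (d - ⌜ x ⌝) n) <n (begin
    + unroll x d                 ≈⟨ %ℕ-mod (d - ⌜ x ⌝) ⟩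
    d - ⌜ x ⌝                    ≈⟨ -cong-mod d≡s+k (mod-refl {n} {⌜ x ⌝}) ⟩
    s + + k - ⌜ x ⌝              ≡⟨ lemma s (+ k) ⌜ x ⌝ ⟩
    s - ⌜ x ⌝ + + k              ≈⟨ +-cong-mod (mod-sym (%ℕ-mod (s - ⌜ x ⌝))) (mod-refl {n} {+ k}) ⟩
    + unroll x s + + k           ≡⟨ ℤP.pos-+ (unroll x s) k ⟨
    + (unroll x s ℕ.+ k)         ∎)
    where
    open mod-Reasoning n
    lemma : ∀ s k x → s + k - x ≡ s - x + k
    lemma = solve-∀
  ... | no ≮n = ⊥-elim (x∉arc (subst (_∈ arc s k) residue≡x (∈-arc s 0<j j≤k)))
    where
    a = unroll x s
    a<n : a ℕ.< n
    a<n = n%ℕd<d (s - ⌜ x ⌝) n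
    j = n ℕ.∸ a
    0<j : 0 ℕ.< j
    0<j = ℕP.m<n⇒0<n∸m a<n
    j≤k : j ℕ.≤ k
    j≤k = ℕP.m≤n+o⇒m∸n≤o n a (ℕP.≮⇒≥ ≮n)
    residue≡x : residue (s + + j) ≡ x
    residue≡x = ⌜⌝-injective-mod (begin
      ⌜ residue (s + + j) ⌝   ≈⟨ ⌜residue⌝ (s + + j) ⟩
      s + + j
        ≡⟨ cong (_+_ s) (trans (sym (ℤP.⊖-≥ (ℕP.<⇒≤ a<n))) (sym (ℤP.m-n≡m⊖n n a))) ⟩
      s + (+ n - + a)
        ≈⟨ +-cong-mod (mod-refl {n} {s}) (-cong-mod (modulus-mod n) (%ℕ-mod (s - ⌜ x ⌝))) ⟩
      s + (0ℤ - (s - ⌜ x ⌝))  ≡⟨ lemma s ⌜ x ⌝ ⟩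
      ⌜ x ⌝                   ∎)
      where
      open mod-Reasoning n
      lemma : ∀ s x → s + (0ℤ - (s - x)) ≡ x
      lemma = solve-∀

  -- The |c| residues passed when walking up from b to a (if c ≥ 0) or from a to b (if c < 0),
  -- where c ≡ a - b.
  crossed : ℤ → ℤ → ℤ → List (Fin n)
  crossed (+ k)    a b = arc b k
  crossed -[1+ k ] a b = arc a (suc k)

  length-crossed : ∀ c a b → length (crossed c a b) ≡ ∣ c ∣
  length-crossed (+ k)    a b = length-arc b k
  length-crossed -[1+ k ] a b = length-arc a (suc k)

  unroll-crossed : ∀ x c a b → c ≡[ n ] a - b → x ∉ crossed c a b → c ≡ + unroll x a - + unroll x b
  unroll-crossed x (+ k) a b c≡a-b x∉ = pos-difference (unroll-arc x b a k (mod-shift c≡a-b) x∉)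
  unroll-crossed x -[1+ k ] a b c≡a-b x∉ =
    trans (cong -_ (pos-difference (unroll-arc x a b (suc k) (mod-shift -c≡b-a) x∉)))
          (neg-difference (+ unroll x b) (+ unroll x a))
    where
    neg-difference : ∀ a b → - (a - b) ≡ b - a
    neg-difference = solve-∀
    -c≡b-a : + suc k ≡[ n ] b - a
    -c≡b-a = mod-trans (-‿cong-mod c≡a-b) (mod-reflexive (neg-difference a b))

  tension-lift : ∀ G c → IsTensionMod n G c → ‖ c ‖₁ ℕ.< n → IsTensionMod 0 G c
  tension-lift G c (p , c≡δp) ‖c‖<n = (λ v → + unroll x (p v)) , λ e →
    mod-reflexive (unroll-crossed x (c e) _ _ (c≡δp e) (x∉crossings ∘ ∈-crossings e))
    where
    crossedBy : Fin (E G) → List (Fin n)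
    crossedBy e = crossed (c e) (p (tail G e)) (p (head G e))
    crossings : List (Fin n)
    crossings = concat (tabulate crossedBy)
    ∈-crossings : ∀ e {y} → y ∈ crossedBy e → y ∈ crossings
    ∈-crossings e y∈ = ∈-concat⁺′ y∈ (∈-tabulate⁺ e)
    |crossings|≡‖c‖ : length crossings ≡ ‖ c ‖₁
    |crossings|≡‖c‖ = trans (length-concat-tabulate crossedBy)
                            (ℕΣ.sum-cong-≗ (λ e → length-crossed (c e) _ _))
    missed : ∃ λ x → x ∉ crossings
    missed = ∃∉ crossings (subst (ℕ._< n) (sym |crossings|≡‖c‖) ‖c‖<n)
    x = proj₁ missed
    x∉crossings = proj₂ missed

pushforward : ∀ {k l} → (Fin k → Fin l) → Vector ℤ k → Vector ℤ l
pushforward f a j = ⟨ (λ i → indicator (f i) j) , a ⟩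

⟨pushforward⟩ : ∀ {k l} (f : Fin k → Fin l) a φ → ⟨ pushforward f a , φ ⟩ ≡ ⟨ a , φ ∘ f ⟩
⟨pushforward⟩ f a φ = trans (⟨⟩-transpose (λ j i → indicator (f i) j) a φ)
                            (sum-cong-≗ (λ i → cong (_*_ (a i)) (∑-indicator (f i) φ)))

∣sum∣≤ : ∀ {k} (g : Vector ℤ k) → ∣ sum g ∣ ℕ.≤ ‖ g ‖₁
∣sum∣≤ {zero}  g = ℕ.z≤n
∣sum∣≤ {suc k} g = ℕP.≤-trans (ℤP.∣i+j∣≤∣i∣+∣j∣ (g zero) (sum (g ∘ suc)))
                              (ℕP.+-monoʳ-≤ ∣ g zero ∣ (∣sum∣≤ (g ∘ suc)))

ℕsum-mono-≤ : ∀ {k} {f g : Vector ℕ k} → (∀ i → f i ℕ.≤ g i) → ℕΣ.sum f ℕ.≤ ℕΣ.sum g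
ℕsum-mono-≤ {zero}  _ = ℕ.z≤n
ℕsum-mono-≤ {suc k} f≤g = ℕP.+-mono-≤ (f≤g zero) (ℕsum-mono-≤ (f≤g ∘ suc))

∣indicator∣ : ∀ {k} (i j : Fin k) → ∣ indicator i j ∣ ≡ ℕIndicator.indicator i j
∣indicator∣ i j with does (i ≟ j)
... | true  = refl
... | false = refl

∣indicator-difference∣ : ∀ {k} (i i′ j : Fin k)
  → ∣ indicator i j - indicator i′ j ∣ ℕ.≤ ℕIndicator.indicator i j ℕ.+ ℕIndicator.indicator i′ j
∣indicator-difference∣ i i′ j with does (i ≟ j) | does (i′ ≟ j)
... | true  | true  = ℕ.z≤n
... | true  | false = ℕP.≤-refl
... | false | true  = ℕP.≤-refl
... | false | false = ℕP.≤-refl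

‖pushforward‖₁≤ : ∀ {k l} (f : Fin k → Fin l) a → ‖ pushforward f a ‖₁ ℕ.≤ ‖ a ‖₁
‖pushforward‖₁≤ f a = begin
  ‖ pushforward f a ‖₁
    ≤⟨ ℕsum-mono-≤ (λ j → ∣sum∣≤ (λ i → indicator (f i) j * a i)) ⟩
  ℕΣ.sum (λ j → ℕΣ.sum (λ i → ∣ indicator (f i) j * a i ∣))
    ≡⟨ ℕΣ.sum-cong-≗ (λ j → ℕΣ.sum-cong-≗ (λ i → trans (ℤP.abs-* (indicator (f i) j) (a i))
                                                        (cong (ℕ._* ∣ a i ∣) (∣indicator∣ (f i) j)))) ⟩
  ℕΣ.sum (λ j → ℕΣ.sum (λ i → δ (f i) j ℕ.* ∣ a i ∣))
    ≡⟨ ℕΣ.∑-comm (λ i j → δ (f i) j ℕ.* ∣ a i ∣) ⟨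
  ℕΣ.sum (λ i → ℕΣ.sum (λ j → δ (f i) j ℕ.* ∣ a i ∣))
    ≡⟨ ℕΣ.sum-cong-≗ (λ i → ℕIndicator.∑-indicator (f i) (λ _ → ∣ a i ∣)) ⟩
  ‖ a ‖₁ ∎
  where
  open ℕP.≤-Reasoning
  open ℕIndicator renaming (indicator to δ)

Σ-fin≡ℕsum : ∀ k g → Σ-fin ℕ.+-0-rawMonoid k g ≡ ℕΣ.sum g
Σ-fin≡ℕsum zero    g = refl
Σ-fin≡ℕsum (suc k) g = cong (ℕ._+_ (g zero)) (Σ-fin≡ℕsum k (g ∘ suc))

‖incidence‖₁≤degree : ∀ G v → ‖ incidence G v ‖₁ ℕ.≤ degree G v
‖incidence‖₁≤degree G v = begin
  ‖ incidence G v ‖₁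
    ≤⟨ ℕsum-mono-≤ (λ e → ∣indicator-difference∣ (tail G e) (head G e) v) ⟩
  ℕΣ.sum (λ e → δ (tail G e) ℕ.+ δ (head G e))
    ≡⟨ ℕΣ.∑-distrib-+ (δ ∘ tail G) (δ ∘ head G) ⟩
  ℕΣ.sum (δ ∘ tail G) ℕ.+ ℕΣ.sum (δ ∘ head G)
    ≡⟨ cong₂ ℕ._+_ (Σ-fin≡ℕsum (E G) _) (Σ-fin≡ℕsum (E G) _) ⟨
  degree G v ∎
  where
  open ℕP.≤-Reasoning
  δ : Fin (V G) → ℕ
  δ y = ℕIndicator.indicator y v

Σ-fin≡sum : ∀ k g → Σ-fin ℤ-group k g ≡ sum g
Σ-fin≡sum zero    g = refl
Σ-fin≡sum (suc k) g = cong (_+_ (g zero)) (Σ-fin≡sum k (g ∘ suc))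

selected-as-product : ∀ b x → (if b then x else 0ℤ) ≡ (if b then 1ℤ else 0ℤ) * x
selected-as-product true  x = sym (ℤP.*-identityˡ x)
selected-as-product false x = sym (ℤP.*-zeroˡ x)

outSum-ℤ : ∀ G φ v → outSum ℤ-group G φ v ≡ outflow G φ v
outSum-ℤ G φ v = trans (Σ-fin≡sum (E G) _) (sum-cong-≗ (λ e → selected-as-product (does (tail G e ≟ v)) (φ e)))

inSum-ℤ : ∀ G φ v → inSum ℤ-group G φ v ≡ inflow G φ v
inSum-ℤ G φ v = trans (Σ-fin≡sum (E G) _) (sum-cong-≗ (λ e → selected-as-product (does (head G e ≟ v)) (φ e)))

isFlow-ℤ⇔ : ∀ G φ → IsFlow ℤ-group G φ ⇔ IsFlowMod 0 G φ
isFlow-ℤ⇔ G φ = mk⇔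
  (λ flow → Equivalence.from (isFlowMod⇔balanced G φ) λ v →
    mod-reflexive (trans (sym (outSum-ℤ G φ v)) (trans (flow v) (inSum-ℤ G φ v))))
  (λ flow v → trans (outSum-ℤ G φ v)
    (trans (mod-0⇒≡ (Equivalence.to (isFlowMod⇔balanced G φ) flow v)) (sym (inSum-ℤ G φ v))))

module _ {n : ℕ} .{{_ : NonZero n}} where

  ⌜mod⌝ : ∀ m → ⌜ m mod n ⌝ ≡[ n ] + m
  ⌜mod⌝ m = mod-trans (mod-reflexive (cong +_ (FinP.toℕ-fromℕ< _))) (%ℕ-mod (+ m))

  ⌜Σ-fin⌝ : ∀ k g → ⌜ Σ-fin (ℤ/ n) k g ⌝ ≡[ n ] sum (⌜_⌝ ∘ g)
  ⌜Σ-fin⌝ zero    g = ⌜mod⌝ 0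
  ⌜Σ-fin⌝ (suc k) g = mod-trans (⌜mod⌝ _)
    (mod-trans (mod-reflexive (ℤP.pos-+ (toℕ (g zero)) _))
               (+-cong-mod (mod-refl {n} {⌜ g zero ⌝}) (⌜Σ-fin⌝ k (g ∘ suc))))

  ⌜selected⌝ : ∀ b x → ⌜ if b then x else 0 mod n ⌝ ≡[ n ] (if b then 1ℤ else 0ℤ) * ⌜ x ⌝
  ⌜selected⌝ true  x = mod-reflexive (sym (ℤP.*-identityˡ ⌜ x ⌝))
  ⌜selected⌝ false x = mod-trans (⌜mod⌝ 0) (mod-reflexive (sym (ℤP.*-zeroˡ ⌜ x ⌝)))

  ⌜outSum⌝ : ∀ G ψ v → ⌜ outSum (ℤ/ n) G ψ v ⌝ ≡[ n ] outflow G (⌜_⌝ ∘ ψ) v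
  ⌜outSum⌝ G ψ v = mod-trans (⌜Σ-fin⌝ (E G) _) (∑-cong-mod (λ e → ⌜selected⌝ (does (tail G e ≟ v)) (ψ e)))

  ⌜inSum⌝ : ∀ G ψ v → ⌜ inSum (ℤ/ n) G ψ v ⌝ ≡[ n ] inflow G (⌜_⌝ ∘ ψ) v
  ⌜inSum⌝ G ψ v = mod-trans (⌜Σ-fin⌝ (E G) _) (∑-cong-mod (λ e → ⌜selected⌝ (does (head G e ≟ v)) (ψ e)))

  isFlow-ℤ/n⇔ : ∀ G ψ → IsFlow (ℤ/ n) G ψ ⇔ IsFlowMod n G (⌜_⌝ ∘ ψ)
  isFlow-ℤ/n⇔ G ψ = mk⇔
    (λ flow → Equivalence.from (isFlowMod⇔balanced G (⌜_⌝ ∘ ψ)) λ v →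
      mod-trans (mod-sym (⌜outSum⌝ G ψ v)) (mod-trans (mod-reflexive (cong ⌜_⌝ (flow v))) (⌜inSum⌝ G ψ v)))
    (λ flow v → ⌜⌝-injective-mod (mod-trans (⌜outSum⌝ G ψ v)
      (mod-trans (Equivalence.to (isFlowMod⇔balanced G (⌜_⌝ ∘ ψ)) flow v) (mod-sym (⌜inSum⌝ G ψ v)))))

FlowContinuousMod : ℕ → (G H : Digraph) → (Fin (E G) → Fin (E H)) → Set
FlowContinuousMod m G H f = ∀ φ → IsFlowMod m H φ → IsFlowMod m G (φ ∘ f)

flowContinuous-ℤ⇔ : ∀ G H f → FlowContinuous ℤ-group G H f ⇔ FlowContinuousMod 0 G H f
flowContinuous-ℤ⇔ G H f = mk⇔
  (λ continuous φ flow → Equivalence.to (isFlow-ℤ⇔ G (φ ∘ f))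
    (continuous φ (Equivalence.from (isFlow-ℤ⇔ H φ) flow)))
  (λ continuous φ flow → Equivalence.from (isFlow-ℤ⇔ G (φ ∘ f))
    (continuous φ (Equivalence.to (isFlow-ℤ⇔ H φ) flow)))

flowContinuous-ℤ/n⇔ : ∀ n .{{_ : NonZero n}} G H f → FlowContinuous (ℤ/ n) G H f ⇔ FlowContinuousMod n G H f
flowContinuous-ℤ/n⇔ n G H f = mk⇔
  (λ continuous φ flow → isFlowMod-resp G (⌜residue⌝ ∘ φ ∘ f)
    (Equivalence.to (isFlow-ℤ/n⇔ G (residue ∘ φ ∘ f))
      (continuous (residue ∘ φ) (Equivalence.from (isFlow-ℤ/n⇔ H (residue ∘ φ))
        (isFlowMod-resp H (mod-sym ∘ ⌜residue⌝ ∘ φ) flow)))))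
  (λ continuous ψ flow → Equivalence.from (isFlow-ℤ/n⇔ G (ψ ∘ f))
    (continuous (⌜_⌝ ∘ ψ) (Equivalence.to (isFlow-ℤ/n⇔ H ψ) flow)))

flowContinuous⇔annihilates : ∀ {m} G H f
  → FlowContinuousMod m G H f ⇔ (∀ v → AnnihilatesFlowsMod m H (pushforward f (incidence G v)))
flowContinuous⇔annihilates {m} G H f = mk⇔
  (λ continuous v φ flow → subst (_≡[ m ] 0ℤ) (sym (⟨pushforward⟩ f (incidence G v) φ)) (continuous φ flow v))
  (λ annihilates φ flow v → subst (_≡[ m ] 0ℤ) (⟨pushforward⟩ f (incidence G v) φ) (annihilates v φ flow))

continuous-mod-0⇒mod : ∀ {m} G H f → FlowContinuousMod 0 G H f → FlowContinuousMod m G H f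
continuous-mod-0⇒mod G H f continuous = Equivalence.from (flowContinuous⇔annihilates G H f) λ v →
  let c = pushforward f (incidence G v)
      q , c≡δq = annihilates⇒tension (tail H) (head H) c
                   (Equivalence.to (flowContinuous⇔annihilates G H f) continuous v)
  in tension⇒annihilates H c (q , mod-0⇒mod ∘ c≡δq)

continuous-mod⇒mod-0 : ∀ n .{{_ : NonZero n}} G H f → MaxDegreeLess G n
  → FlowContinuousMod n G H f → FlowContinuousMod 0 G H f
continuous-mod⇒mod-0 n G H f degree<n continuous = Equivalence.from (flowContinuous⇔annihilates G H f) λ v →
  let c = pushforward f (incidence G v)
      tension = annihilates⇒tension (tail H) (head H) c
                  (Equivalence.to (flowContinuous⇔annihilates G H f) continuous v)
      ‖c‖<n = ℕP.≤-<-trans (ℕP.≤-trans (‖pushforward‖₁≤ f (incidence G v)) (‖incidence‖₁≤degree G v))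
                           (degree<n v)
  in tension⇒annihilates H c (tension-lift H c tension ‖c‖<n)

theorem3p1 : (n : ℕ) → .{{_ : NonZero n}} → 3 < n → (G H : Digraph)
    → MaxDegreeLess G n → MaxDegreeLess H n
    → (Σ (Fin (E G) → Fin (E H)) (FlowContinuous (ℤ/ n) G H))
    ⇔ (Σ (Fin (E G) → Fin (E H)) (FlowContinuous ℤ-group G H))
theorem3p1 n _ G H degree<n _ = mk⇔
  (λ (f , continuous) → f , Equivalence.from (flowContinuous-ℤ⇔ G H f)
    (continuous-mod⇒mod-0 n G H f degree<n (Equivalence.to (flowContinuous-ℤ/n⇔ n G H f) continuous)))
  (λ (f , continuous) → f , Equivalence.from (flowContinuous-ℤ/n⇔ n G H f)
    (continuous-mod-0⇒mod G H f (Equivalence.to (flowContinuous-ℤ⇔ G H f) continuous)))
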